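{- Let $(\mathscr A,\preceq,\cdot)$ be an applicative structure and set $a\leadsto b:=\bigvee\{c\in\mathscr A\mid c\cdot a\preceq b\}$. Then $(\mathscr A,\preceq,\leadsto)$ is an implicative structure, and its application, defined by $ab:=\bigwedge\{c\in\mathscr A\mid a\preceq (b\leadsto c)\}$, satisfies $ab=a\cdot b$ for all $a,b\in\mathscr A$.
   Context: An applicative structure $(\mathscr A,\preceq,\cdot)$ is a complete lattice with a binary operation $\cdot$ such that $a\preceq a'$, $b\preceq b'$ imply $a\cdot b\preceq a'\cdot b'$, and $\bigvee_{a\in A}(a\cdot b)=(\bigvee_{a\in A}a)\cdot b$. An implicative structure $(\mathscr A,\preceq,\to)$ is a complete lattice with a binary operation $\to$ such that $a'\preceq a$, $b\preceq b'$ imply $(a\to b)\preceq(a'\to b')$, and $a\to\bigwedge_{b\in B}b=\bigwedge_{b\in B}(a\to b)$ for every $B\subseteq\mathscr A$. -}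

module Defs where

open import Level using (Level; _⊔_; suc; Lift)
open import Data.Product using (Σ; _,_; proj₁)
open import Relation.Binary.Bundles using (Poset)

-- A complete lattice: a poset in which every family indexed by a type of
-- level (c ⊔ ℓ) (in particular every subset {x | P x}, as Σ Carrier P)
-- has a least upper bound ⋁ and a greatest lower bound ⋀.
record CompleteLattice (c ℓ₁ ℓ₂ : Level) : Set (suc (c ⊔ ℓ₁ ⊔ ℓ₂)) where
  field
    poset : Poset c ℓ₁ ℓ₂
  open Poset poset public
  field
    ⋁       : {I : Set (c ⊔ ℓ₂)} → (I → Carrier) → Carrier
    ⋁-upper : {I : Set (c ⊔ ℓ₂)} (f : I → Carrier) (i : I) → f i ≤ ⋁ f
    ⋁-least : {I : Set (c ⊔ ℓ₂)} (f : I → Carrier) (x : Carrier) →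
              (∀ i → f i ≤ x) → ⋁ f ≤ x
    ⋀       : {I : Set (c ⊔ ℓ₂)} → (I → Carrier) → Carrier
    ⋀-lower : {I : Set (c ⊔ ℓ₂)} (f : I → Carrier) (i : I) → ⋀ f ≤ f i
    ⋀-great : {I : Set (c ⊔ ℓ₂)} (f : I → Carrier) (x : Carrier) →
              (∀ i → x ≤ f i) → x ≤ ⋀ f

  ⋁ˢ : (Carrier → Set (c ⊔ ℓ₂)) → Carrier
  ⋁ˢ P = ⋁ {Σ Carrier P} proj₁

  ⋀ˢ : (Carrier → Set (c ⊔ ℓ₂)) → Carrier
  ⋀ˢ P = ⋀ {Σ Carrier P} proj₁

module _ {c ℓ₁ ℓ₂ : Level} (L : CompleteLattice c ℓ₁ ℓ₂) where
  open CompleteLattice L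

  record IsApplicative (_·_ : Carrier → Carrier → Carrier) : Set (suc (c ⊔ ℓ₁ ⊔ ℓ₂)) where
    field
      ·-mono : ∀ {a a′ b b′} → a ≤ a′ → b ≤ b′ → (a · b) ≤ (a′ · b′)
      ·-⋁    : {I : Set (c ⊔ ℓ₂)} (f : I → Carrier) (b : Carrier) →
               ⋁ (λ i → f i · b) ≈ (⋁ f · b)

  record IsImplicative (_⇒_ : Carrier → Carrier → Carrier) : Set (suc (c ⊔ ℓ₁ ⊔ ℓ₂)) where
    field
      ⇒-mono : ∀ {a a′ b b′} → a′ ≤ a → b ≤ b′ → (a ⇒ b) ≤ (a′ ⇒ b′)
      ⇒-⋀    : {I : Set (c ⊔ ℓ₂)} (a : Carrier) (f : I → Carrier) →
               (a ⇒ ⋀ f) ≈ ⋀ (λ i → a ⇒ f i)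

  leadsto : (Carrier → Carrier → Carrier) → Carrier → Carrier → Carrier
  leadsto _·_ a b = ⋁ˢ (λ x → Lift c ((x · a) ≤ b))

  implApp : (Carrier → Carrier → Carrier) → Carrier → Carrier → Carrier
  implApp _⇒_ a b = ⋀ˢ (λ x → Lift c (a ≤ (b ⇒ x)))

-- Because application preserves joins in its left argument, x ↦ x · a is left
-- adjoint to b ↦ a ↝ b, i.e. x · a ⪯ b ⇔ x ⪯ a ↝ b. Right adjoints preserve
-- meets, which gives the implicative structure, and a · b is then the least c
-- with a ⪯ b ↝ c, which is exactly the induced application.
module Submission where

open import Defs
open import Data.Product using (_×_; _,_; proj₁; proj₂)
open import Level using (_⊔_; lift; lower)

module Leadsto {c ℓ₁ ℓ₂} (L : CompleteLattice c ℓ₁ ℓ₂)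
  (_·_ : CompleteLattice.Carrier L → CompleteLattice.Carrier L → CompleteLattice.Carrier L)
  (isApplicative : IsApplicative L _·_) where
  open CompleteLattice L
  open IsApplicative isApplicative

  _↝_ : Carrier → Carrier → Carrier
  _↝_ = leadsto L _·_

  ·⇒≤↝ : ∀ {x a b} → (x · a) ≤ b → x ≤ (a ↝ b)
  ·⇒≤↝ {x} xa≤b = ⋁-upper proj₁ (x , lift xa≤b)

  ↝-eval : ∀ {a b} → ((a ↝ b) · a) ≤ b
  ↝-eval {a} {b} = begin
    (a ↝ b) · a                 ≈⟨ Eq.sym (·-⋁ proj₁ a) ⟩
    ⋁ (λ i → proj₁ i · a)       ≤⟨ ⋁-least _ b (λ i → lower (proj₂ i)) ⟩
    b                           ∎
    where open import Relation.Binary.Reasoning.PartialOrder poset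

  ≤↝⇒· : ∀ {x a b} → x ≤ (a ↝ b) → (x · a) ≤ b
  ≤↝⇒· x≤a↝b = trans (·-mono x≤a↝b refl) ↝-eval

  ↝-mono : ∀ {a a′ b b′} → a′ ≤ a → b ≤ b′ → (a ↝ b) ≤ (a′ ↝ b′)
  ↝-mono a′≤a b≤b′ = ·⇒≤↝ (trans (·-mono refl a′≤a) (trans ↝-eval b≤b′))

  ↝-⋀ : ∀ {I : Set (c ⊔ ℓ₂)} (a : Carrier) (f : I → Carrier) →
        (a ↝ ⋀ f) ≈ ⋀ (λ i → a ↝ f i)
  ↝-⋀ a f = antisym
    (⋀-great _ _ (λ i → ↝-mono refl (⋀-lower f i)))
    (·⇒≤↝ (⋀-great f _ (λ i → ≤↝⇒· (⋀-lower _ i))))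

  isImplicative : IsImplicative L _↝_
  isImplicative = record { ⇒-mono = ↝-mono ; ⇒-⋀ = ↝-⋀ }

  implApp≈· : ∀ a b → implApp L _↝_ a b ≈ (a · b)
  implApp≈· a b = antisym
    (⋀-lower proj₁ ((a · b) , lift (·⇒≤↝ refl)))
    (⋀-great proj₁ _ (λ i → ≤↝⇒· (lower (proj₂ i))))

proposition2p3 : {c ℓ₁ ℓ₂ : _} (L : CompleteLattice c ℓ₁ ℓ₂)
    (_·_ : CompleteLattice.Carrier L → CompleteLattice.Carrier L → CompleteLattice.Carrier L) →
    IsApplicative L _·_ →
    IsImplicative L (leadsto L _·_)
      × (∀ a b → CompleteLattice._≈_ L (implApp L (leadsto L _·_) a b) (a · b))
proposition2p3 L _·_ isApplicative =
  isImplicative , implApp≈·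
  where open Leadsto L _·_ isApplicative
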